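{- For integers $0\le k\le n$ and $0\le m\le\min(k,n-k)$, let \[P(n,k,m)=\sum_{i=0}^{m-1}\sum_{j=0}^{i}\binom ij\left((k-j)2^{k-j-1}+2^{n-i-1}\right)+\sum_{i=0}^{m}\binom miP(n-m,k-i).\] Then $P(n,k,m)=P(n,k)$ for all $0\le m\le\min(k,n-k)$.
   Context: For a power of two $M$ let $O(M)=\frac M4(\log_2^2M-\log_2M+4)-1$. For powers of two $1\le K\le N$ define $H(N,K)$ (the number of comparators of the improved pairwise selection network $pw\_hbit\_sel^N_K$) by $H(N,1)=N-1$; $H(N,N)=O(N)$ for $N>1$; $H(N,K)=H(N/2,K)+H(N/2,K/2)+\frac N2+\frac{K\log_2K}{2}$ for $1<K<N$. Set $P(n,k)=H(2^n,2^k)$ for integers $0\le k\le n$. -}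

module Defs where

open import Data.Nat using (ℕ; zero; suc; _+_; _*_; _∸_; _^_; _/_; _<?_)
open import Data.Nat.Combinatorics using (_C_)
open import Data.Bool using (if_then_else_)
open import Relation.Nullary.Decidable using (⌊_⌋)

sumTo : ℕ → (ℕ → ℕ) → ℕ
sumTo zero    f = 0
sumTo (suc m) f = sumTo m f + f m

-- O(2^n) = 2^n/4 * (n^2 - n + 4) - 1  (an exact division; written with exponent n)
O : ℕ → ℕ
O n = (2 ^ n * (n * n ∸ n + 4)) / 4 ∸ 1

-- P n k = H(2^n, 2^k), following the recursion for H with N = 2^n, K = 2^k:
--   H(N,1) = N - 1
--   H(N,N) = O(N) for N > 1
--   H(N,K) = H(N/2,K) + H(N/2,K/2) + N/2 + K log₂ K / 2  for 1 < K < N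
-- Values for k > n are junk (H is only defined for K ≤ N).
P : ℕ → ℕ → ℕ
P n       zero    = 2 ^ n ∸ 1
P zero    (suc k) = 0
P (suc n) (suc k) =
  if ⌊ k <? n ⌋
  then P n (suc k) + P n k + 2 ^ n + (suc k * 2 ^ suc k) / 2
  else O (suc n)

P3 : ℕ → ℕ → ℕ → ℕ
P3 n k m =
  sumTo m (λ i → sumTo (suc i) (λ j →
      (i C j) * ((k ∸ j) * 2 ^ (k ∸ j ∸ 1) + 2 ^ (n ∸ i ∸ 1))))
  + sumTo (suc m) (λ i → (m C i) * P (n ∸ m) (k ∸ i))

-- Passing from m to m + 1 unfolds every P(n - m, k - i) once by the
-- recursion for H, which applies since 1 ≤ k - i < n - m. The non-recursive parts of
-- these unfoldings form exactly the new summand i = m of the double sum, and the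
-- recursive parts C(m,i) (P(n-m-1, k-i) + P(n-m-1, k-i-1)) recombine by Pascal's rule
-- into Σ C(m+1,i) P(n-m-1, k-i).
module Submission where

open import Defs
open import Data.Nat using (ℕ; zero; suc; _+_; _*_; _∸_; _^_; _/_; _≤_; _<_; _<?_; z≤n; s≤s; s≤s⁻¹)
open import Data.Nat.Properties
open import Algebra.Properties.CommutativeSemigroup +-commutativeSemigroup
  using (interchange)
open import Data.Nat.DivMod using (m*n/n≡m)
open import Data.Nat.Combinatorics using (_C_; nCk+nC[k+1]≡[n+1]C[k+1]; k>n⇒nCk≡0)
open import Function using (_∘_)
open import Relation.Binary.PropositionalEquality
  using (_≡_; refl; sym; trans; cong; cong₂; module ≡-Reasoning)
open import Relation.Nullary using (yes; no; contradiction)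

open ≡-Reasoning

sumTo-cong : ∀ n {f g : ℕ → ℕ} → (∀ i → i < n → f i ≡ g i) → sumTo n f ≡ sumTo n g
sumTo-cong zero    f≗g = refl
sumTo-cong (suc n) f≗g =
  cong₂ _+_ (sumTo-cong n (λ i i<n → f≗g i (m≤n⇒m≤1+n i<n))) (f≗g n ≤-refl)

sumTo-+ : ∀ n (f g : ℕ → ℕ) → sumTo n (λ i → f i + g i) ≡ sumTo n f + sumTo n g
sumTo-+ zero    f g = refl
sumTo-+ (suc n) f g = begin
  sumTo n (λ i → f i + g i) + (f n + g n)  ≡⟨ cong (_+ (f n + g n)) (sumTo-+ n f g) ⟩
  (sumTo n f + sumTo n g) + (f n + g n)    ≡⟨ interchange (sumTo n f) (sumTo n g) (f n) (g n) ⟩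
  (sumTo n f + f n) + (sumTo n g + g n)    ∎

sumTo-head : ∀ n (f : ℕ → ℕ) → sumTo (suc n) f ≡ f 0 + sumTo n (f ∘ suc)
sumTo-head zero    f = +-comm 0 (f 0)
sumTo-head (suc n) f = begin
  sumTo (suc n) f + f (suc n)              ≡⟨ cong (_+ f (suc n)) (sumTo-head n f) ⟩
  (f 0 + sumTo n (f ∘ suc)) + f (suc n)    ≡⟨ +-assoc (f 0) _ _ ⟩
  f 0 + (sumTo n (f ∘ suc) + f (suc n))    ∎

sumTo-binomial-head : ∀ n m (g : ℕ → ℕ) →
  sumTo (suc n) (λ i → (m C i) * g i) ≡ g 0 + sumTo n (λ i → (m C suc i) * g (suc i))
sumTo-binomial-head n m g =
  trans (sumTo-head n (λ i → (m C i) * g i))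
        (cong (_+ sumTo n (λ i → (m C suc i) * g (suc i))) (+-identityʳ (g 0)))

sumTo-pascal : ∀ m (g : ℕ → ℕ) →
  sumTo (suc m) (λ i → (m C i) * g i) + sumTo (suc m) (λ i → (m C i) * g (suc i))
  ≡ sumTo (suc (suc m)) (λ i → (suc m C i) * g i)
sumTo-pascal m g = begin
  A + X                ≡⟨ cong (_+ X) A≡g₀+Y ⟩
  (g 0 + Y) + X        ≡⟨ +-assoc (g 0) Y X ⟩
  g 0 + (Y + X)        ≡⟨ cong (g 0 +_) (+-comm Y X) ⟩
  g 0 + (X + Y)        ≡⟨ cong (g 0 +_) (sym (sumTo-+ (suc m) _ _)) ⟩
  g 0 + sumTo (suc m) (λ i → (m C i) * g (suc i) + (m C suc i) * g (suc i))
    ≡⟨ cong (g 0 +_) (sumTo-cong (suc m) λ i _ →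
         trans (sym (*-distribʳ-+ (g (suc i)) (m C i) (m C suc i)))
               (cong (_* g (suc i)) (nCk+nC[k+1]≡[n+1]C[k+1] m i))) ⟩
  g 0 + sumTo (suc m) (λ i → (suc m C suc i) * g (suc i))
    ≡⟨ sym (sumTo-binomial-head (suc m) (suc m) g) ⟩
  sumTo (suc (suc m)) (λ i → (suc m C i) * g i) ∎
  where
  A = sumTo (suc m) (λ i → (m C i) * g i)
  X = sumTo (suc m) (λ i → (m C i) * g (suc i))
  Y = sumTo (suc m) (λ i → (m C suc i) * g (suc i))
  A≡g₀+Y : A ≡ g 0 + Y
  A≡g₀+Y = begin
    A                                          ≡⟨ sym (+-identityʳ A) ⟩
    A + 0                                      ≡⟨ cong (A +_) (sym (cong (_* g (suc m)) (k>n⇒nCk≡0 (n<1+n m)))) ⟩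
    sumTo (suc (suc m)) (λ i → (m C i) * g i)  ≡⟨ sumTo-binomial-head (suc m) m g ⟩
    g 0 + Y                                    ∎

sumTo-binomial-recurrence : ∀ m (f h g : ℕ → ℕ) → (∀ i → i ≤ m → f i ≡ h i + (g i + g (suc i))) →
  sumTo (suc m) (λ i → (m C i) * f i)
  ≡ sumTo (suc m) (λ i → (m C i) * h i) + sumTo (suc (suc m)) (λ i → (suc m C i) * g i)
sumTo-binomial-recurrence m f h g f≡h+g+g = begin
  sumTo (suc m) (λ i → (m C i) * f i)
    ≡⟨ sumTo-cong (suc m) (λ i i<1+m → distrib i (f≡h+g+g i (s≤s⁻¹ i<1+m))) ⟩
  sumTo (suc m) (λ i → (m C i) * h i + ((m C i) * g i + (m C i) * g (suc i)))
    ≡⟨ sumTo-+ (suc m) _ _ ⟩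
  H + sumTo (suc m) (λ i → (m C i) * g i + (m C i) * g (suc i))
    ≡⟨ cong (H +_) (trans (sumTo-+ (suc m) _ _) (sumTo-pascal m g)) ⟩
  H + sumTo (suc (suc m)) (λ i → (suc m C i) * g i) ∎
  where
  H = sumTo (suc m) (λ i → (m C i) * h i)
  distrib : ∀ i → f i ≡ h i + (g i + g (suc i)) →
    (m C i) * f i ≡ (m C i) * h i + ((m C i) * g i + (m C i) * g (suc i))
  distrib i eq = begin
    (m C i) * f i                                          ≡⟨ cong ((m C i) *_) eq ⟩
    (m C i) * (h i + (g i + g (suc i)))                    ≡⟨ *-distribˡ-+ (m C i) (h i) _ ⟩
    (m C i) * h i + (m C i) * (g i + g (suc i))            ≡⟨ cong ((m C i) * h i +_) (*-distribˡ-+ (m C i) (g i) _) ⟩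
    (m C i) * h i + ((m C i) * g i + (m C i) * g (suc i))  ∎

m>n⇒m∸n≡1+[m∸[1+n]] : ∀ {m n} → n < m → m ∸ n ≡ suc (m ∸ suc n)
m>n⇒m∸n≡1+[m∸[1+n]] {suc m} {zero}  _         = refl
m>n⇒m∸n≡1+[m∸[1+n]] {suc m} {suc n} (s≤s n<m) = m>n⇒m∸n≡1+[m∸[1+n]] n<m

n*2^[1+k]/2≡n*2^k : ∀ n k → (n * 2 ^ suc k) / 2 ≡ n * 2 ^ k
n*2^[1+k]/2≡n*2^k n k = trans (cong (_/ 2) reassoc) (m*n/n≡m (n * 2 ^ k) 2)
  where
  reassoc : n * (2 * 2 ^ k) ≡ n * 2 ^ k * 2
  reassoc = trans (cong (n *_) (*-comm 2 (2 ^ k))) (sym (*-assoc n (2 ^ k) 2))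

P-suc-suc : ∀ n k → k < n → P (suc n) (suc k) ≡ (suc k * 2 ^ k + 2 ^ n) + (P n (suc k) + P n k)
P-suc-suc n k k<n with k <? n
... | no k≮n = contradiction k<n k≮n
... | yes _  = begin
  P n (suc k) + P n k + 2 ^ n + (suc k * 2 ^ suc k) / 2  ≡⟨ cong (Q + 2 ^ n +_) (n*2^[1+k]/2≡n*2^k (suc k) k) ⟩
  Q + 2 ^ n + suc k * 2 ^ k                              ≡⟨ +-comm (Q + 2 ^ n) _ ⟩
  suc k * 2 ^ k + (Q + 2 ^ n)                            ≡⟨ cong (suc k * 2 ^ k +_) (+-comm Q (2 ^ n)) ⟩
  suc k * 2 ^ k + (2 ^ n + Q)                            ≡⟨ +-assoc (suc k * 2 ^ k) (2 ^ n) Q ⟨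
  (suc k * 2 ^ k + 2 ^ n) + Q                            ∎
  where
  Q = P n (suc k) + P n k

P3-suc : ∀ n k m → k ≤ n → m < k → m < n ∸ k → P3 n k (suc m) ≡ P3 n k m
P3-suc n k m k≤n m<k m<n∸k =
  trans (+-assoc (sumTo m outer) _ _)
        (cong (sumTo m outer +_) (sym (sumTo-binomial-recurrence m f h g unfold)))
  where
  outer f h g : ℕ → ℕ
  outer i = sumTo (suc i) (λ j → (i C j) * ((k ∸ j) * 2 ^ (k ∸ j ∸ 1) + 2 ^ (n ∸ i ∸ 1)))
  f i = P (n ∸ m) (k ∸ i)
  h i = (k ∸ i) * 2 ^ (k ∸ i ∸ 1) + 2 ^ (n ∸ m ∸ 1)
  g i = P (n ∸ suc m) (k ∸ i)

  k≤n∸[1+m] : k ≤ n ∸ suc m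
  k≤n∸[1+m] = ≤-trans (≤-reflexive (sym (m∸[m∸n]≡n k≤n))) (∸-monoʳ-≤ n m<n∸k)

  m<n : m < n
  m<n = ≤-trans m<n∸k (m∸n≤m n k)

  unfold : ∀ i → i ≤ m → f i ≡ h i + (g i + g (suc i))
  unfold i i≤m = unfold-below (≤-trans (s≤s i≤m) m<k)
    where
    unfold-below : i < k → f i ≡ h i + (g i + g (suc i))
    unfold-below i<k
      rewrite m>n⇒m∸n≡1+[m∸[1+n]] m<n | m>n⇒m∸n≡1+[m∸[1+n]] i<k =
      P-suc-suc (n ∸ suc m) (k ∸ suc i) (<-≤-trans (∸-monoʳ-< (s≤s z≤n) i<k) k≤n∸[1+m])

lemma9 : (n k m : ℕ) → k ≤ n → m ≤ k → m ≤ n ∸ k → P3 n k m ≡ P n k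
lemma9 n k zero    _   _   _     = +-identityʳ (P n k)
lemma9 n k (suc m) k≤n m<k m<n∸k =
  trans (P3-suc n k m k≤n m<k m<n∸k)
        (lemma9 n k m k≤n (<⇒≤ m<k) (<⇒≤ m<n∸k))
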